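{- For every program $\mathcal{X}\in\mathbb{P}$, every family of programs $\{\mathcal{Y}_n\mid n\in\mathbb{N}\}\subseteq\mathbb{P}$, and each $\Join\in\{\parallel,;\}$: $\mathcal{X}\Join\bigl(\bigcup_{n}\mathcal{Y}_n\bigr)=\bigcup_{n}(\mathcal{X}\Join\mathcal{Y}_n)$ and $\bigl(\bigcup_{n}\mathcal{Y}_n\bigr)\Join\mathcal{X}=\bigcup_{n}(\mathcal{Y}_n\Join\mathcal{X})$.
   Context: Fix an alphabet $\Gamma$ and a nonempty (infinite) set $E$ of events, large enough that the event sets of the compositions below are again subsets of $E$. A partial string is a triple $p=\langle E_p,\alpha_p,\preceq_p\rangle$ with $E_p\subseteq E$, $\alpha_p\colon E_p\to\Gamma$, and $\preceq_p$ a partial order on $E_p$; $\mathsf{P}_f$ is the set of finite partial strings. A monotonic bijective morphism $f\colon x\to y$ is a bijection $f\colon E_x\to E_y$ with $e\preceq_x e'\Rightarrow f(e)\preceq_y f(e')$ and $\alpha_x(e)=\alpha_y(f(e))$. Write $x\sqsubseteq y$ iff there is a monotonic bijective morphism $y\to x$. For sets $S,T$ let $S+T=(S\times\{0\})\cup(T\times\{1\})$. For partial strings $x,y$, $x\parallel y$ and $x;y$ both have event set $E_x+E_y$ and labelling $\alpha(\langle e,0\rangle)=\alpha_x(e)$, $\alpha(\langle e,1\rangle)=\alpha_y(e)$; the order of $x\parallel y$ is: $\langle e,i\rangle\preceq\langle e',j\rangle$ iff ($i=j=0$ and $e\preceq_x e'$) or ($i=j=1$ and $e\preceq_y e'$);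 the order of $x;y$ is: $\langle e,i\rangle\preceq\langle e',j\rangle$ iff $i<j$ or $\langle e,i\rangle\preceq_{x\parallel y}\langle e',j\rangle$. A program is a set $\mathcal{X}\subseteq\mathsf{P}_f$ with $\downarrow\mathcal{X}=\mathcal{X}$, where $\downarrow\mathcal{X}=\{y\in\mathsf{P}_f\mid\exists x\in\mathcal{X}\colon y\sqsubseteq x\}$; $\mathbb{P}$ is the family of programs. For programs and $\Join\in\{\parallel,;\}$, $\mathcal{X}\Join\mathcal{Y}=\downarrow\{x\Join y\mid x\in\mathcal{X},y\in\mathcal{Y}\}$. -}

module Defs where

open import Level using (Level; 0ℓ) renaming (suc to lsuc)
open import Data.Nat using (ℕ)
open import Data.Fin using (Fin)
open import Data.Bool using (Bool; true; false)
open import Data.Empty using (⊥)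
open import Data.Unit using (⊤)
open import Data.Sum using (_⊎_; inj₁; inj₂)
open import Data.Product using (Σ; _×_; _,_)
open import Function.Bundles using (_↔_)
open import Function.Definitions using (Injective; Bijective)
open import Relation.Binary.PropositionalEquality using (_≡_)
open import Relation.Binary.Structures using (IsPartialOrder)

-- The standing setting: an alphabet Γ, a nonempty set E of events, and the
-- tagging map e ↦ ⟨e,i⟩ (i ∈ {0,1}, with false = 0, true = 1) that realises
-- S + T = (S×{0}) ∪ (T×{1}) inside E ("E large enough").  Injectivity of
-- the tagging (jointly in both arguments) is what makes S + T a disjoint
-- union inside E; together with nonemptiness it forces E to be infinite.
record Setting : Set₁ where
  field
    Γ        : Set
    E        : Set
    e₀       : E
    tag      : E → Bool → E
    tag-inj  : ∀ e i e′ j → tag e i ≡ tag e′ j → (e ≡ e′) × (i ≡ j)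

data Op : Set where
  par seq : Op

module _ (S : Setting) where
  open Setting S

  -- A (raw) partial string: its event set is the image of the injective map
  -- ev : C → E (C is the event set up to that identification), with a
  -- labelling and a relation on events.
  record PStr : Set₁ where
    field
      C    : Set
      ev   : C → E
      lab  : C → Γ
      _≼_  : C → C → Set

  open PStr public

  record InPf (p : PStr) : Set where
    field
      ev-inj   : Injective _≡_ _≡_ (ev p)
      isPO     : IsPartialOrder _≡_ (_≼_ p)
      finite   : Σ ℕ (λ n → C p ↔ Fin n)

  MBMorph : PStr → PStr → Set
  MBMorph x y =
    Σ (C x → C y) λ f →
      Bijective _≡_ _≡_ f
      × (∀ {a b} → _≼_ x a b → _≼_ y (f a) (f b))
      × (∀ a → lab x a ≡ lab y (f a))

  _⊑_ : PStr → PStr → Set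
  x ⊑ y = MBMorph y x

  PSet : Set₂
  PSet = PStr → Set₁

  _⊆ˢ_ : PSet → PSet → Set₁
  A ⊆ˢ B = ∀ z → A z → B z

  _≐_ : PSet → PSet → Set₁
  A ≐ B = (A ⊆ˢ B) × (B ⊆ˢ A)

  ↓ : PSet → PSet
  ↓ X y = InPf y × Σ PStr (λ x → X x × (y ⊑ x))

  IsProgram : PSet → Set₁
  IsProgram X = ↓ X ≐ X

  ⋃ : (ℕ → PSet) → PSet
  ⋃ Y z = Σ ℕ (λ n → Y n z)

  parOrd : (x y : PStr) → C x ⊎ C y → C x ⊎ C y → Set
  parOrd x y (inj₁ a) (inj₁ b) = _≼_ x a b
  parOrd x y (inj₂ a) (inj₂ b) = _≼_ y a b
  parOrd x y (inj₁ a) (inj₂ b) = ⊥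
  parOrd x y (inj₂ a) (inj₁ b) = ⊥

  seqOrd : (x y : PStr) → C x ⊎ C y → C x ⊎ C y → Set
  seqOrd x y (inj₁ a) (inj₂ b) = ⊤
  seqOrd x y a b = parOrd x y a b

  compOrd : Op → (x y : PStr) → C x ⊎ C y → C x ⊎ C y → Set
  compOrd par = parOrd
  compOrd seq = seqOrd

  comp : Op → PStr → PStr → PStr
  comp o x y = record
    { C   = C x ⊎ C y
    ; ev  = λ { (inj₁ a) → tag (ev x a) false ; (inj₂ b) → tag (ev y b) true }
    ; lab = λ { (inj₁ a) → lab x a ; (inj₂ b) → lab y b }
    ; _≼_ = compOrd o x y
    }

  compP : Op → PSet → PSet → PSet
  compP o X Y = ↓ (λ z → Σ PStr λ x → Σ PStr λ y → X x × Y y × (z ≡ comp o x y))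

-- Downward closure and the set of pairwise compositions { x ⋈ y } are both
-- defined by existential quantification, so each commutes with countable
-- unions; composing the two equalities gives the distributive laws.  In
-- particular the laws hold for arbitrary sets of partial strings, not only
-- for downward-closed ones.
module Submission where

open import Defs
open import Data.Nat using (ℕ)
open import Function using (_∘_)
open import Data.Product using (Σ; _×_; _,_)
open import Relation.Binary.PropositionalEquality using (_≡_)

module _ (S : Setting) where

  ≐-trans : {A B C : PSet S} → _≐_ S A B → _≐_ S B C → _≐_ S A C
  ≐-trans (A⊆B , B⊆A) (B⊆C , C⊆B) =
    (λ z → B⊆C z ∘ A⊆B z) , (λ z → B⊆A z ∘ C⊆B z)

  ↓-cong : {A B : PSet S} → _≐_ S A B → _≐_ S (↓ S A) (↓ S B)
  ↓-cong (A⊆B , B⊆A) =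
    (λ { z (pf , x , Ax , z⊑x) → pf , x , A⊆B x Ax , z⊑x })
    , (λ { z (pf , x , Bx , z⊑x) → pf , x , B⊆A x Bx , z⊑x })

  ↓-⋃ : (A : ℕ → PSet S) → _≐_ S (↓ S (⋃ S A)) (⋃ S (λ n → ↓ S (A n)))
  ↓-⋃ A =
    (λ { z (pf , x , (n , Ax) , z⊑x) → n , pf , x , Ax , z⊑x })
    , (λ { z (n , pf , x , Ax , z⊑x) → pf , x , (n , Ax) , z⊑x })

  compositions : Op → PSet S → PSet S → PSet S
  compositions o X Y z =
    Σ (PStr S) λ x → Σ (PStr S) λ y → X x × Y y × (z ≡ comp S o x y)

  compositions-⋃ʳ : (o : Op) (X : PSet S) (Y : ℕ → PSet S)
    → _≐_ S (compositions o X (⋃ S Y)) (⋃ S (λ n → compositions o X (Y n)))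
  compositions-⋃ʳ o X Y =
    (λ { z (x , y , Xx , (n , Yy) , eq) → n , x , y , Xx , Yy , eq })
    , (λ { z (n , x , y , Xx , Yy , eq) → x , y , Xx , (n , Yy) , eq })

  compositions-⋃ˡ : (o : Op) (Y : ℕ → PSet S) (X : PSet S)
    → _≐_ S (compositions o (⋃ S Y) X) (⋃ S (λ n → compositions o (Y n) X))
  compositions-⋃ˡ o Y X =
    (λ { z (y , x , (n , Yy) , Xx , eq) → n , y , x , Yy , Xx , eq })
    , (λ { z (n , y , x , Yy , Xx , eq) → y , x , (n , Yy) , Xx , eq })

mainTheorem15 : (S : Setting) (X : PSet S) (Y : ℕ → PSet S)
    → IsProgram S X → (∀ n → IsProgram S (Y n)) → (o : Op)
    → _≐_ S (compP S o X (⋃ S Y)) (⋃ S (λ n → compP S o X (Y n)))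
    × _≐_ S (compP S o (⋃ S Y) X) (⋃ S (λ n → compP S o (Y n) X))
mainTheorem15 S X Y _ _ o =
  ≐-trans S (↓-cong S (compositions-⋃ʳ S o X Y))
            (↓-⋃ S (λ n → compositions S o X (Y n)))
  , ≐-trans S (↓-cong S (compositions-⋃ˡ S o Y X))
              (↓-⋃ S (λ n → compositions S o (Y n) X))
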